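{- For integers $m,s\geq 1$ let $E^+_{m,*}(s)$ denote the number of self-conjugate partitions with distinct parts that are simultaneously $s$-cores and $(ms+1)$-cores. Then $E^+_{m,*}(1)=1$, $E^+_{m,*}(2)=m+1$, and for all $m\geq 1$ and $\alpha>1$: \begin{enumerate} \item $E^+_{m,*}(2\alpha)=m\alpha+1$, and \item $E^+_{m,*}(2\alpha+1)=\alpha+1$. \end{enumerate}
   Context: A partition is self-conjugate if its Young diagram is symmetric about the main diagonal. An $a$-core is a partition with no hook length equal to $a$. The empty partition is counted. -}

module Defs where

open import Data.Nat using (ℕ; zero; suc; _+_; _*_; _∸_; _<_; _>_; _≥_; _<?_)
open import Data.List using (List; []; _∷_; length; map; filter; upTo)
open import Data.List.Relation.Unary.All using (All)
open import Data.List.Relation.Unary.Linked using (Linked)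
open import Data.List.Relation.Unary.Unique.Propositional using (Unique)
open import Data.List.Membership.Propositional using (_∈_)
open import Data.Product using (Σ; _×_)
open import Relation.Binary.PropositionalEquality using (_≡_; _≢_)
open import Function.Bundles using (_⇔_)

IsPartition : List ℕ → Set
IsPartition λs = All (0 <_) λs × Linked _≥_ λs

HasDistinctParts : List ℕ → Set
HasDistinctParts λs = Linked _>_ λs

-- i-th part (0-indexed), 0 beyond the length
part : List ℕ → ℕ → ℕ
part []       _       = 0
part (x ∷ _)  zero    = x
part (_ ∷ xs) (suc i) = part xs i

conjugate : List ℕ → List ℕ
conjugate λs = map (λ j → length (filter (j <?_) λs)) (upTo (part λs 0))

SelfConjugate : List ℕ → Set
SelfConjugate λs = conjugate λs ≡ λs

hook : List ℕ → ℕ → ℕ → ℕ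
hook λs i j = ((part λs i ∸ j) + (part (conjugate λs) j ∸ i)) ∸ 1

IsCore : ℕ → List ℕ → Set
IsCore a λs = ∀ i j → i < length λs → j < part λs i → hook λs i j ≢ a

SCDCore : ℕ → ℕ → List ℕ → Set
SCDCore m s λs =
  IsPartition λs × SelfConjugate λs × HasDistinctParts λs
  × IsCore s λs × IsCore (m * s + 1) λs

HasCount : (List ℕ → Set) → ℕ → Set
HasCount P n = Σ (List (List ℕ)) λ L →
  Unique L × (∀ λs → (λs ∈ L) ⇔ P λs) × (length L ≡ n)

E⁺ : ℕ → ℕ → ℕ → Set
E⁺ m s n = HasCount (SCDCore m s) n

-- A self-conjugate partition with distinct parts has as many parts as its largest part, and a
-- strictly decreasing sequence of positive integers can only do that if it is the staircase
-- (k, k-1, …, 1). The hook lengths of the staircase k are exactly the odd numbers 1, 3, …, 2k-1,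
-- so it is an a-core for every even a, and a (2c+1)-core iff k ≤ c. Hence for s = 2α only the
-- odd number ms+1 = 2mα+1 constrains k, giving k ≤ mα; for odd s = 2α+1 the condition k ≤ α
-- already makes the larger ms+1 harmless.
module Submission where

open import Defs
open import Data.Nat using (ℕ; zero; suc; _+_; _*_; _∸_; _≤_; _<_; _≥_; _>_; _<?_; s≤s; s≤s⁻¹; z<s)
open import Data.Nat.Properties
open import Algebra.Properties.CommutativeSemigroup *-commutativeSemigroup using (x∙yz≈y∙xz)
open import Data.List using (List; []; _∷_; length; filter; applyUpTo)
open import Data.List.Properties using (map-upTo; length-applyUpTo; filter-accept; filter-reject)
open import Data.List.Relation.Unary.All using (All; []; _∷_)
open import Data.List.Relation.Unary.Linked as Linked using (Linked; []; [-]; _∷_)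
open import Data.List.Relation.Unary.Unique.Propositional.Properties using (applyUpTo⁺₁)
open import Data.List.Membership.Propositional using (_∈_)
open import Data.List.Membership.Propositional.Properties using (∈-applyUpTo⁺; ∈-applyUpTo⁻)
open import Data.Product using (_×_; _,_; ∃-syntax)
open import Relation.Nullary using (yes; no; contradiction)
open import Relation.Binary.PropositionalEquality
open import Function.Base using (_∘_)
open import Function.Bundles using (_⇔_; mk⇔; Equivalence)

staircase : ℕ → List ℕ
staircase zero    = []
staircase (suc k) = suc k ∷ staircase k

length-staircase : ∀ k → length (staircase k) ≡ k
length-staircase zero    = refl
length-staircase (suc k) = cong suc (length-staircase k)

part-staircase : ∀ k i → part (staircase k) i ≡ k ∸ i
part-staircase zero    zero    = refl
part-staircase zero    (suc i) = refl
part-staircase (suc k) zero    = refl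
part-staircase (suc k) (suc i) = part-staircase k i

staircase-injective : ∀ {k l} → staircase k ≡ staircase l → k ≡ l
staircase-injective {k} {l} eq =
  trans (sym (length-staircase k)) (trans (cong length eq) (length-staircase l))

staircase-positive : ∀ k → All (0 <_) (staircase k)
staircase-positive zero    = []
staircase-positive (suc k) = z<s ∷ staircase-positive k

staircase-decreasing : ∀ k → Linked _>_ (staircase k)
staircase-decreasing zero          = []
staircase-decreasing (suc zero)    = [-]
staircase-decreasing (suc (suc k)) = ≤-refl ∷ staircase-decreasing (suc k)

length-filter-staircase : ∀ k j → length (filter (j <?_) (staircase k)) ≡ k ∸ j
length-filter-staircase zero    j = sym (0∸n≡0 j)
length-filter-staircase (suc k) j with j <? suc k
... | yes j<1+k = begin
  length (filter (j <?_) (suc k ∷ staircase k)) ≡⟨ cong length (filter-accept (j <?_) j<1+k) ⟩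
  suc (length (filter (j <?_) (staircase k)))   ≡⟨ cong suc (length-filter-staircase k j) ⟩
  suc (k ∸ j)                                   ≡⟨ sym (+-∸-assoc 1 (m<1+n⇒m≤n j<1+k)) ⟩
  suc k ∸ j                                     ∎
  where open ≡-Reasoning
... | no j≮1+k = begin
  length (filter (j <?_) (suc k ∷ staircase k)) ≡⟨ cong length (filter-reject (j <?_) j≮1+k) ⟩
  length (filter (j <?_) (staircase k))         ≡⟨ length-filter-staircase k j ⟩
  k ∸ j                                         ≡⟨ m≤n⇒m∸n≡0 (≤-trans (n≤1+n k) (≮⇒≥ j≮1+k)) ⟩
  0                                             ≡⟨ sym (m≤n⇒m∸n≡0 (≮⇒≥ j≮1+k)) ⟩
  suc k ∸ j                                     ∎
  where open ≡-Reasoning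

applyUpTo-staircase : ∀ k {g : ℕ → ℕ} → (∀ j → g j ≡ k ∸ j) → applyUpTo g k ≡ staircase k
applyUpTo-staircase zero    g≗ = refl
applyUpTo-staircase (suc k) g≗ = cong₂ _∷_ (g≗ 0) (applyUpTo-staircase k (λ j → g≗ (suc j)))

conjugate-staircase : ∀ k → conjugate (staircase k) ≡ staircase k
conjugate-staircase zero    = refl
conjugate-staircase (suc k) =
  trans (map-upTo _ (suc k)) (applyUpTo-staircase (suc k) (length-filter-staircase (suc k)))

staircase-scd : ∀ k → IsPartition (staircase k) × SelfConjugate (staircase k) × HasDistinctParts (staircase k)
staircase-scd k =
  (staircase-positive k , Linked.map <⇒≤ (staircase-decreasing k)) , conjugate-staircase k , staircase-decreasing k

length≤head : ∀ x xs → All (0 <_) (x ∷ xs) → Linked _>_ (x ∷ xs) → length (x ∷ xs) ≤ x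
length≤head x []       (0<x ∷ _)  _          = 0<x
length≤head x (y ∷ ys) (_ ∷ pos) (y<x ∷ dec) = ≤-trans (s≤s (length≤head y ys pos dec)) y<x

-- Each step of a strictly decreasing positive list goes down by at least one, so if the head
-- equals the length every step goes down by exactly one.
head≡length⇒staircase : ∀ λs → All (0 <_) λs → Linked _>_ λs → part λs 0 ≡ length λs →
                        λs ≡ staircase (length λs)
head≡length⇒staircase []           _         _          _   = refl
head≡length⇒staircase (x ∷ [])     _         _          x≡1 = cong (_∷ []) x≡1
head≡length⇒staircase (x ∷ y ∷ ys) (_ ∷ pos) (y<x ∷ dec) x≡len =
  cong₂ _∷_ x≡len (head≡length⇒staircase (y ∷ ys) pos dec y≡len)
  where
  y≡len : y ≡ length (y ∷ ys)
  y≡len = ≤-antisym (m<1+n⇒m≤n (subst (y <_) x≡len y<x)) (length≤head y ys pos dec)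

length-conjugate : ∀ λs → length (conjugate λs) ≡ part λs 0
length-conjugate λs = trans (cong length (map-upTo _ (part λs 0))) (length-applyUpTo _ (part λs 0))

scd⇒staircase : ∀ {λs} → IsPartition λs → SelfConjugate λs → HasDistinctParts λs →
                λs ≡ staircase (length λs)
scd⇒staircase {λs} (pos , _) sc dec =
  head≡length⇒staircase λs pos dec (trans (sym (length-conjugate λs)) (cong length sc))

hook-staircase : ∀ k i j → hook (staircase k) i j ≡ 2 * (k ∸ (i + j)) ∸ 1
hook-staircase k i j
  rewrite conjugate-staircase k | part-staircase k i | part-staircase k j
        | ∸-+-assoc k i j | ∸-+-assoc k j i | +-comm j i | +-identityʳ (k ∸ (i + j)) = refl

2*suc∸1 : ∀ u → 2 * suc u ∸ 1 ≡ suc (2 * u)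
2*suc∸1 u = cong (_∸ 1) (*-suc 2 u)

j<k∸i⇒i+j<k : ∀ k i {j} → j < k ∸ i → i + j < k
j<k∸i⇒i+j<k zero    zero    ()
j<k∸i⇒i+j<k zero    (suc i) ()
j<k∸i⇒i+j<k (suc k) zero    j<k     = j<k
j<k∸i⇒i+j<k (suc k) (suc i) j<k∸i = s≤s (j<k∸i⇒i+j<k k i j<k∸i)

staircase-cell⇒hook : ∀ {k i j} → j < part (staircase k) i →
                      ∃[ u ] u < k × hook (staircase k) i j ≡ suc (2 * u)
staircase-cell⇒hook {k} {i} {j} j<part =
  k ∸ suc (i + j) , ∸-monoʳ-< z<s i+j<k , (begin
    hook (staircase k) i j        ≡⟨ hook-staircase k i j ⟩
    2 * (k ∸ (i + j)) ∸ 1         ≡⟨ cong (λ t → 2 * t ∸ 1) (+-∸-assoc 1 i+j<k) ⟩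
    2 * suc (k ∸ suc (i + j)) ∸ 1 ≡⟨ 2*suc∸1 _ ⟩
    suc (2 * (k ∸ suc (i + j)))   ∎)
  where
  open ≡-Reasoning
  i+j<k : i + j < k
  i+j<k = j<k∸i⇒i+j<k k i (subst (j <_) (part-staircase k i) j<part)

staircase-first-row-hook : ∀ {k u} → u < k → hook (staircase k) 0 (k ∸ suc u) ≡ suc (2 * u)
staircase-first-row-hook {k} {u} u<k = begin
  hook (staircase k) 0 (k ∸ suc u) ≡⟨ hook-staircase k 0 (k ∸ suc u) ⟩
  2 * (k ∸ (k ∸ suc u)) ∸ 1        ≡⟨ cong (λ t → 2 * t ∸ 1) (m∸[m∸n]≡n u<k) ⟩
  2 * suc u ∸ 1                    ≡⟨ 2*suc∸1 u ⟩
  suc (2 * u)                      ∎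
  where open ≡-Reasoning

staircase-core⇔ : ∀ a k → IsCore a (staircase k) ⇔ (∀ u → u < k → suc (2 * u) ≢ a)
staircase-core⇔ a k = mk⇔ core⇒ core⇐
  where
  core⇒ : IsCore a (staircase k) → ∀ u → u < k → suc (2 * u) ≢ a
  core⇒ core u u<k hook≡a = core 0 (k ∸ suc u) 0<len first-row
    (trans (staircase-first-row-hook u<k) hook≡a)
    where
    0<len : 0 < length (staircase k)
    0<len = subst (0 <_) (sym (length-staircase k)) (≤-trans z<s u<k)
    first-row : k ∸ suc u < part (staircase k) 0
    first-row = subst (k ∸ suc u <_) (sym (part-staircase k 0)) (∸-monoʳ-< z<s u<k)
  core⇐ : (∀ u → u < k → suc (2 * u) ≢ a) → IsCore a (staircase k)
  core⇐ avoid i j _ j<part hook≡a with staircase-cell⇒hook j<part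
  ... | u , u<k , hook≡ = avoid u u<k (trans (sym hook≡) hook≡a)

staircase-core-even : ∀ c k → IsCore (2 * c) (staircase k)
staircase-core-even c k =
  Equivalence.from (staircase-core⇔ (2 * c) k) (λ u _ odd≡even → even≢odd c u (sym odd≡even))

staircase-core-large : ∀ {a} k → 2 * k ≤ a → IsCore a (staircase k)
staircase-core-large {a} k 2k≤a = Equivalence.from (staircase-core⇔ a k) λ u u<k →
  <⇒≢ (<-≤-trans (≤-trans (≤-reflexive (sym (*-suc 2 u))) (*-monoʳ-≤ 2 u<k)) 2k≤a)

staircase-core-odd⇔ : ∀ c k → IsCore (suc (2 * c)) (staircase k) ⇔ k ≤ c
staircase-core-odd⇔ c k = mk⇔ core⇒k≤c (λ k≤c → staircase-core-large k (m≤n⇒m≤1+n (*-monoʳ-≤ 2 k≤c)))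
  where
  core⇒k≤c : IsCore (suc (2 * c)) (staircase k) → k ≤ c
  core⇒k≤c core with c <? k
  ... | yes c<k = contradiction refl (Equivalence.to (staircase-core⇔ _ k) core c c<k)
  ... | no  c≮k = ≮⇒≥ c≮k

staircases-hasCount : ∀ {P : List ℕ → Set} n →
                      (∀ λs → P λs ⇔ (∃[ k ] k < n × λs ≡ staircase k)) → HasCount P n
staircases-hasCount {P} n P⇔ =
  applyUpTo staircase n ,
  applyUpTo⁺₁ staircase n (λ i<j _ → <⇒≢ i<j ∘ staircase-injective) ,
  (λ λs → mk⇔ (Equivalence.from (P⇔ λs) ∘ ∈-applyUpTo⁻ staircase) (mem λs ∘ Equivalence.to (P⇔ λs))) ,
  length-applyUpTo staircase n
  where
  mem : ∀ λs → ∃[ k ] k < n × λs ≡ staircase k → λs ∈ applyUpTo staircase n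
  mem _ (k , k<n , refl) = ∈-applyUpTo⁺ staircase k<n

SCDCore⇔staircase : ∀ m s λs →
  SCDCore m s λs ⇔ (∃[ k ] λs ≡ staircase k × IsCore s (staircase k) × IsCore (m * s + 1) (staircase k))
SCDCore⇔staircase m s λs = mk⇔ to from
  where
  to : SCDCore m s λs → ∃[ k ] λs ≡ staircase k × IsCore s (staircase k) × IsCore (m * s + 1) (staircase k)
  to (partition , sc , distinct , s-core , ms+1-core) =
    length λs , λs≡ , subst (IsCore s) λs≡ s-core , subst (IsCore (m * s + 1)) λs≡ ms+1-core
    where
    λs≡ : λs ≡ staircase (length λs)
    λs≡ = scd⇒staircase partition sc distinct
  from : ∃[ k ] λs ≡ staircase k × IsCore s (staircase k) × IsCore (m * s + 1) (staircase k) → SCDCore m s λs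
  from (k , refl , s-core , ms+1-core) = let (partition , sc , distinct) = staircase-scd k in
    partition , sc , distinct , s-core , ms+1-core

E⁺-staircases : ∀ m s n →
  (∀ k → (IsCore s (staircase k) × IsCore (m * s + 1) (staircase k)) ⇔ k < n) → E⁺ m s n
E⁺-staircases m s n cores⇔ = staircases-hasCount n λ λs → mk⇔
  (λ scd → let (k , λs≡ , cores) = Equivalence.to (SCDCore⇔staircase m s λs) scd in
    k , Equivalence.to (cores⇔ k) cores , λs≡)
  (λ { (k , k<n , refl) → Equivalence.from (SCDCore⇔staircase m s _) (k , refl , Equivalence.from (cores⇔ k) k<n) })

E⁺-even : ∀ m d → E⁺ m (2 * d) (suc (m * d))
E⁺-even m d = E⁺-staircases m (2 * d) (suc (m * d)) λ k → mk⇔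
  (λ (_ , ms+1-core) → s≤s (Equivalence.to (ms+1-core⇔ k) ms+1-core))
  (λ k<1+md → staircase-core-even d k , Equivalence.from (ms+1-core⇔ k) (s≤s⁻¹ k<1+md))
  where
  ms+1≡odd : m * (2 * d) + 1 ≡ suc (2 * (m * d))
  ms+1≡odd = trans (+-comm _ 1) (cong suc (x∙yz≈y∙xz m 2 d))
  ms+1-core⇔ : ∀ k → IsCore (m * (2 * d) + 1) (staircase k) ⇔ k ≤ m * d
  ms+1-core⇔ k = subst (λ a → IsCore a (staircase k) ⇔ k ≤ m * d) (sym ms+1≡odd) (staircase-core-odd⇔ (m * d) k)

E⁺-odd : ∀ m c → m ≥ 1 → E⁺ m (suc (2 * c)) (suc c)
E⁺-odd m c m≥1 = E⁺-staircases m s (suc c) λ k → mk⇔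
  (λ (s-core , _) → s≤s (Equivalence.to (staircase-core-odd⇔ c k) s-core))
  (λ k<1+c → let k≤c = s≤s⁻¹ k<1+c in
    Equivalence.from (staircase-core-odd⇔ c k) k≤c ,
    staircase-core-large k (≤-trans (*-monoʳ-≤ 2 k≤c) 2c≤ms+1))
  where
  s = suc (2 * c)
  2c≤ms+1 : 2 * c ≤ m * s + 1
  2c≤ms+1 = begin
    2 * c     ≤⟨ n≤1+n (2 * c) ⟩
    s         ≡⟨ sym (*-identityˡ s) ⟩
    1 * s     ≤⟨ *-monoˡ-≤ s m≥1 ⟩
    m * s     ≤⟨ m≤m+n (m * s) 1 ⟩
    m * s + 1 ∎
    where open ≤-Reasoning

proposition6p7 : ∀ (m : ℕ) → m ≥ 1 →
      E⁺ m 1 1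
    × E⁺ m 2 (m + 1)
    × (∀ (α : ℕ) → α > 1 →
         E⁺ m (2 * α) (m * α + 1) × E⁺ m (2 * α + 1) (α + 1))
proposition6p7 m m≥1 =
  E⁺-odd m 0 m≥1 ,
  subst (E⁺ m 2) (trans (cong suc (*-identityʳ m)) (+-comm 1 m)) (E⁺-even m 1) ,
  λ α _ → subst (E⁺ m (2 * α)) (+-comm 1 (m * α)) (E⁺-even m α) ,
          subst₂ (E⁺ m) (+-comm 1 (2 * α)) (+-comm 1 α) (E⁺-odd m α m≥1)
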